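{- For integers $n\geq 0$ and $k$ let $a(n,k)=\binom{n}{k}^2\binom{2n-2k}{n-k}$ (with $\binom{m}{j}=0$ if $j<0$ or $j>m$). For $n\geq 1$, $0\leq t\leq n$ and integers $0\leq k\leq t/2$ define $$\mathcal{L}_t(a(n,k))=a(n+1,k)a(n-1,t-k)+a(n-1,k)a(n+1,t-k)-2a(n,k)a(n,t-k).$$ Then for every $n\geq 1$ and every integer $0\leq t\leq n$ there exists an index $k'$ (depending on $n,t$) such that $\mathcal{L}_t(a(n,k))\geq 0$ for all integers $0\leq k\leq k'$ and $\mathcal{L}_t(a(n,k))\leq 0$ for all integers $k'<k\leq t/2$.
   Context: All of $n,t,k$ are nonnegative integers. Binomial coefficients $\binom{m}{j}$ are taken to be $0$ when $j<0$ or $j>m$. -}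

module Defs where

open import Data.Nat using (ℕ; suc; _*_; _∸_)
open import Data.Nat.Combinatorics using (_C_)
open import Data.Integer as ℤ using (ℤ; +_)

-- a(n,k) = C(n,k)^2 * C(2n-2k, n-k) for natural n, k.
-- (stdlib's n C k is 0 when k > n; and then the whole product is 0.)
a : ℕ → ℕ → ℕ
a n k = (n C k) * (n C k) * ((2 * n ∸ 2 * k) C (n ∸ k))

-- L_t(a(n,k)) = a(n+1,k)a(n-1,t-k)+a(n-1,k)a(n+1,t-k)-2a(n,k)a(n,t-k), in ℤ; used only for n ≥ 1, 2k ≤ t (so n∸1, t∸k are exact).
L : ℕ → ℕ → ℕ → ℤ
L n t k =
  ((+ (a (suc n) k * a (n ∸ 1) (t ∸ k)) ℤ.+ + (a (n ∸ 1) k * a (suc n) (t ∸ k)))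
    ℤ.- + (2 * a n k * a n (t ∸ k)))

module Submission where

-- Write n = N + 1.  For a pair of columns k, j ≤ N the ratio identity
--   a(n+1, k)·(m+1)³ = a(n, k)·2(n+1)²(2m+1)      (m = n - k)
-- expresses a(N+2, k) and a(N, k) as rational multiples of a(N+1, k) > 0.  Substituting these
-- into L_{k+j}(a(N+1, k)) ≥ 0 and clearing the (positive) denominators turns the inequality
-- into  2(N+1)²·Y(p,q) ≤ (N+2)²·X(p,q)  for explicit polynomials X, Y in the distances
-- p = N - k, q = N - j to the end of the row.  A polynomial identity with positive remainder
-- shows that X/Y does not decrease under (p, q) ↦ (p+1, q-1) while p ≥ q, so moving one column
-- to the left along the anti-diagonal k + j = t preserves L ≥ 0; the single pair that leaves
-- the row (j = N + 1, k = 0) is checked directly.  Hence, for fixed t ≤ n, the columns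
-- k ≤ t/2 with L_t ≥ 0 form an initial segment, and k′ is its last element (or -1).

open import Defs
open import Data.Nat using (ℕ; _≤_; _*_; _≥_)
open import Data.Integer as ℤ using (ℤ; +_)
open import Data.Product using (∃-syntax; _×_)

open import Data.Nat using (zero; suc; _+_; _∸_; _!; _≤?_; z≤n; s≤s; s≤s⁻¹; NonZero; >-nonZero)
open import Data.Nat.Properties
open import Data.Nat.Combinatorics using (_C_; nCk≡n!/k![n-k]!; k![n∸k]!∣n!)
open import Data.Nat.DivMod using (m/n*n≡m)
open import Data.Nat.Tactic.RingSolver using (solve-∀)
open import Data.Integer.Properties using (drop‿+≤+; drop‿+<+; i≤j⇒0≤j-i; i≤j⇒i-j≤0)
open import Data.Product using (_,_; proj₂)
open import Data.Sum using (inj₁; inj₂)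
open import Function.Bundles using (_⇔_; mk⇔; Equivalence)
open import Function.Properties.Equivalence using () renaming (trans to ⇔-trans)
open import Relation.Binary.PropositionalEquality
open import Relation.Nullary using (¬_; yes; no; contradiction)
open import Relation.Nullary.Decidable using (_×-dec_)
open import Relation.Unary using (Decidable)

open Equivalence using (to; from)

-- x³, written as a product so that the ring solver sees a polynomial once it is unfolded.
cube : ℕ → ℕ
cube x = x * x * x

C-factorial : ∀ {n k} → k ≤ n → (n C k) * (k ! * (n ∸ k) !) ≡ n !
C-factorial {n} {k} k≤n = trans (cong (_* (k ! * (n ∸ k) !)) (nCk≡n!/k![n-k]! k≤n))
                                (m/n*n≡m {{k !* (n ∸ k) !≢0}} (k![n∸k]!∣n! k≤n))

C-factorial⁺ : ∀ k m → ((k + m) C k) * (k ! * m !) ≡ (k + m) !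
C-factorial⁺ k m = subst (λ x → ((k + m) C k) * (k ! * x !) ≡ (k + m) !)
                         (m+n∸m≡n k m) (C-factorial (m≤m+n k m))

-- Binomial coefficients inside the triangle are nonzero, since their multiple (k+m)! is.
C-nonZero : ∀ k m → NonZero ((k + m) C k)
C-nonZero k m = >-nonZero (n≢0⇒n>0 λ c≡0 → <⇒≢ (1≤n! (k + m)) (begin
  0                              ≡⟨ cong (_* (k ! * m !)) c≡0 ⟨
  ((k + m) C k) * (k ! * m !)    ≡⟨ C-factorial⁺ k m ⟩
  (k + m) ! ∎))
  where open ≡-Reasoning

C-column-step : ∀ k m → suc m * (suc (k + m) C k) ≡ suc (k + m) * ((k + m) C k)
C-column-step k m = *-cancelʳ-≡ _ _ (k ! * m !) {{k !* m !≢0}} (begin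
  suc m * (suc (k + m) C k) * (k ! * m !)      ≡⟨ regroup (suc m) (suc (k + m) C k) (k !) (m !) ⟩
  (suc (k + m) C k) * (k ! * (suc m) !)        ≡⟨ subst (λ n → (n C k) * (k ! * (suc m) !) ≡ n !)
                                                        (+-suc k m) (C-factorial⁺ k (suc m)) ⟩
  suc (k + m) * (k + m) !                      ≡⟨ cong (suc (k + m) *_) (C-factorial⁺ k m) ⟨
  suc (k + m) * (((k + m) C k) * (k ! * m !))  ≡⟨ *-assoc (suc (k + m)) ((k + m) C k) (k ! * m !) ⟨
  suc (k + m) * ((k + m) C k) * (k ! * m !)    ∎)
  where
  open ≡-Reasoning
  regroup : ∀ s c f g → s * c * (f * g) ≡ c * (f * (s * g))
  regroup = solve-∀

C-central-step : ∀ m → suc m * ((suc m + suc m) C suc m) ≡ 2 * suc (2 * m) * ((m + m) C m)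
C-central-step m = *-cancelʳ-≡ _ _ (suc m * (m ! * m !)) {{m*n≢0 (suc m) (m ! * m !) {{_}} {{m !* m !≢0}}}} (begin
  suc m * C₁ * (suc m * (m ! * m !))                ≡⟨ regroup (suc m) C₁ (m !) ⟩
  C₁ * ((suc m) ! * (suc m) !)                      ≡⟨ C-factorial⁺ (suc m) (suc m) ⟩
  suc (m + suc m) * (m + suc m) !                   ≡⟨ cong (λ x → suc (m + suc m) * x !) (+-suc m m) ⟩
  suc (m + suc m) * (suc (m + m) * (m + m) !)       ≡⟨ cong (λ x → suc (m + suc m) * (suc (m + m) * x))
                                                           (C-factorial⁺ m m) ⟨
  suc (m + suc m) * (suc (m + m) * (C₀ * (m ! * m !))) ≡⟨ expand m C₀ (m !) ⟩
  2 * suc (2 * m) * C₀ * (suc m * (m ! * m !))       ∎)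
  where
  open ≡-Reasoning
  C₀ C₁ : ℕ
  C₀ = (m + m) C m
  C₁ = (suc m + suc m) C suc m
  regroup : ∀ s c g → s * c * (s * (g * g)) ≡ c * ((s * g) * (s * g))
  regroup = solve-∀
  expand : ∀ m c g → suc (m + suc m) * (suc (m + m) * (c * (g * g))) ≡ 2 * suc (2 * m) * c * (suc m * (g * g))
  expand = solve-∀

a-coordinates : ∀ k m → a (k + m) k ≡ ((k + m) C k) * ((k + m) C k) * ((m + m) C m)
a-coordinates k m = cong₂ (λ x y → ((k + m) C k) * ((k + m) C k) * (x C y)) double-difference (m+n∸m≡n k m)
  where
  double-difference : 2 * (k + m) ∸ 2 * k ≡ m + m
  double-difference = trans (cong (_∸ 2 * k) (distribute k m)) (m+n∸m≡n (2 * k) (m + m))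
    where
    distribute : ∀ k m → 2 * (k + m) ≡ 2 * k + (m + m)
    distribute = solve-∀

a-nonZero : ∀ {n} k m → n ≡ k + m → NonZero (a n k)
a-nonZero k m refl = subst NonZero (sym (a-coordinates k m))
  (m*n≢0 _ _ {{m*n≢0 _ _ {{C-nonZero k m}} {{C-nonZero k m}}}} {{C-nonZero m m}})

a-row-ratio : ∀ {n} k m → n ≡ k + m →
  a (suc n) k * cube (suc m) ≡ a n k * (2 * (suc n * suc n) * suc (2 * m))
a-row-ratio k m refl = begin
  a (suc (k + m)) k * cube (suc m)                   ≡⟨ cong (_* cube (suc m)) next-row ⟩
  (C₁ * C₁ * D₁) * cube (suc m)                      ≡⟨ regroup (suc m) C₁ D₁ ⟩
  (suc m * C₁) * (suc m * C₁) * (suc m * D₁)         ≡⟨ cong₂ (λ x y → x * x * y) (C-column-step k m) (C-central-step m) ⟩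
  (s * C₀) * (s * C₀) * (2 * suc (2 * m) * D₀)       ≡⟨ collect s C₀ D₀ m ⟩
  (C₀ * C₀ * D₀) * (2 * (s * s) * suc (2 * m))       ≡⟨ cong (_* (2 * (s * s) * suc (2 * m))) (a-coordinates k m) ⟨
  a (k + m) k * (2 * (s * s) * suc (2 * m))          ∎
  where
  open ≡-Reasoning
  s C₀ C₁ D₀ D₁ : ℕ
  s  = suc (k + m)
  C₀ = (k + m) C k
  C₁ = suc (k + m) C k
  D₀ = (m + m) C m
  D₁ = (suc m + suc m) C suc m
  next-row : a (suc (k + m)) k ≡ C₁ * C₁ * D₁
  next-row = subst (λ n → a n k ≡ (n C k) * (n C k) * D₁) (+-suc k m) (a-coordinates k (suc m))
  regroup : ∀ x c d → (c * c * d) * (x * x * x) ≡ (x * c) * (x * c) * (x * d)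
  regroup = solve-∀
  collect : ∀ s c d m → (s * c) * (s * c) * (2 * suc (2 * m) * d) ≡ (c * c * d) * (2 * (s * s) * suc (2 * m))
  collect = solve-∀

cross-multiply : ∀ A B U V U′ V′ d₀ e₀ d₁ e₁ d₀′ e₀′ d₁′ e₁′ →
  U * d₁ ≡ A * e₁ → A * d₀ ≡ V * e₀ → U′ * d₁′ ≡ B * e₁′ → B * d₀′ ≡ V′ * e₀′ →
  (U * V′ + V * U′) * (d₁ * d₁′ * e₀ * e₀′) ≡ A * B * (e₁ * e₀ * d₀′ * d₁′ + e₁′ * e₀′ * d₀ * d₁)
cross-multiply A B U V U′ V′ d₀ e₀ d₁ e₁ d₀′ e₀′ d₁′ e₁′ U≡ A≡ U′≡ B≡ = begin
  (U * V′ + V * U′) * (d₁ * d₁′ * e₀ * e₀′)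
    ≡⟨ spread d₁ d₁′ e₀ e₀′ U V′ V U′ ⟩
  (U * d₁) * (V′ * e₀′) * (d₁′ * e₀) + (V * e₀) * (U′ * d₁′) * (d₁ * e₀′)
    ≡⟨ cong₂ (λ x y → x * y * (d₁′ * e₀) + (V * e₀) * (U′ * d₁′) * (d₁ * e₀′)) U≡ (sym B≡) ⟩
  (A * e₁) * (B * d₀′) * (d₁′ * e₀) + (V * e₀) * (U′ * d₁′) * (d₁ * e₀′)
    ≡⟨ cong₂ (λ x y → (A * e₁) * (B * d₀′) * (d₁′ * e₀) + x * y * (d₁ * e₀′)) (sym A≡) U′≡ ⟩
  (A * e₁) * (B * d₀′) * (d₁′ * e₀) + (A * d₀) * (B * e₁′) * (d₁ * e₀′)
    ≡⟨ collect A B d₀ e₀ d₁ e₁ d₀′ e₀′ d₁′ e₁′ ⟩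
  A * B * (e₁ * e₀ * d₀′ * d₁′ + e₁′ * e₀′ * d₀ * d₁) ∎
  where
  open ≡-Reasoning
  spread : ∀ d₁ d₁′ e₀ e₀′ U V′ V U′ → (U * V′ + V * U′) * (d₁ * d₁′ * e₀ * e₀′)
         ≡ (U * d₁) * (V′ * e₀′) * (d₁′ * e₀) + (V * e₀) * (U′ * d₁′) * (d₁ * e₀′)
  spread = solve-∀
  collect : ∀ A B d₀ e₀ d₁ e₁ d₀′ e₀′ d₁′ e₁′ →
    (A * e₁) * (B * d₀′) * (d₁′ * e₀) + (A * d₀) * (B * e₁′) * (d₁ * e₀′)
    ≡ A * B * (e₁ * e₀ * d₀′ * d₁′ + e₁′ * e₀′ * d₀ * d₁)
  collect = solve-∀

compare-twice-product : ∀ {A B D S W} .{{_ : NonZero (A * B)}} .{{_ : NonZero D}} →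
  S * D ≡ A * B * W → (2 * A * B ≤ S ⇔ 2 * D ≤ W)
compare-twice-product {A} {B} {D} {S} {W} SD≡ = mk⇔
  (λ 2AB≤S → *-cancelˡ-≤ (A * B) (begin
      A * B * (2 * D)  ≡⟨ swap A B D ⟩
      D * (2 * A * B)  ≤⟨ *-monoʳ-≤ D 2AB≤S ⟩
      D * S            ≡⟨ *-comm D S ⟩
      S * D            ≡⟨ SD≡ ⟩
      A * B * W        ∎))
  (λ 2D≤W → *-cancelˡ-≤ D (begin
      D * (2 * A * B)  ≡⟨ swap A B D ⟨
      A * B * (2 * D)  ≤⟨ *-monoʳ-≤ (A * B) 2D≤W ⟩
      A * B * W        ≡⟨ SD≡ ⟨
      S * D            ≡⟨ *-comm S D ⟩
      D * S            ∎))
  where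
  open ≤-Reasoning
  swap : ∀ A B D → A * B * (2 * D) ≡ D * (2 * A * B)
  swap = solve-∀

cancel-factor : ∀ K {u v x y} .{{_ : NonZero K}} → u ≡ K * x → v ≡ K * y → (u ≤ v ⇔ x ≤ y)
cancel-factor K refl refl = mk⇔ (*-cancelˡ-≤ K) (*-monoʳ-≤ K)

-- L_{k+j}(a(N+1, k)) ≥ 0, written in ℕ:  2·a(N+1,k)·a(N+1,j) ≤ a(N+2,k)·a(N,j) + a(N,k)·a(N+2,j).
NonNegL : ℕ → ℕ → ℕ → Set
NonNegL N k j = 2 * a (suc N) k * a (suc N) j ≤ a (suc (suc N)) k * a N j + a N k * a (suc (suc N)) j

-- The polynomials left after dividing L by a(N+1,k)·a(N+1,j) and clearing denominators,
-- as functions of the distances p = N - k and q = N - j to the end of the row.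
X : ℕ → ℕ → ℕ
X p q = suc (2 * p) * suc (2 * suc p) * cube (suc q) * cube (suc (suc q))
      + suc (2 * q) * suc (2 * suc q) * cube (suc p) * cube (suc (suc p))

Y : ℕ → ℕ → ℕ
Y p q = cube (suc (suc p)) * cube (suc (suc q)) * suc (2 * p) * suc (2 * q)

Reduced : ℕ → ℕ → ℕ → Set
Reduced N p q = 2 * (suc N * suc N) * Y p q ≤ suc (suc N) * suc (suc N) * X p q

NonNegL⇔Reduced : ∀ {N} k j p q → N ≡ k + p → N ≡ j + q → NonNegL N k j ⇔ Reduced N p q
NonNegL⇔Reduced {N} k j p q N≡k+p N≡j+q =
  ⇔-trans (compare-twice-product {A} {B} {D} {S} {W} {{AB≢0}} SD≡ABW)
          (cancel-factor (4 * (suc N * suc N)) (twice-D n² p q d₁ d₁′)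
            (W-factored n² m² p q d₀ d₁ d₀′ d₁′))
  where
  n² m² A U V B U′ V′ d₀ e₀ d₁ e₁ d₀′ e₀′ d₁′ e₁′ S D W : ℕ
  n² = suc N * suc N
  m² = suc (suc N) * suc (suc N)
  A  = a (suc N) k
  U  = a (suc (suc N)) k
  V  = a N k
  B  = a (suc N) j
  U′ = a (suc (suc N)) j
  V′ = a N j
  d₀ = cube (suc p)
  e₀ = 2 * n² * suc (2 * p)
  d₁ = cube (suc (suc p))
  e₁ = 2 * m² * suc (2 * suc p)
  d₀′ = cube (suc q)
  e₀′ = 2 * n² * suc (2 * q)
  d₁′ = cube (suc (suc q))
  e₁′ = 2 * m² * suc (2 * suc q)
  S = U * V′ + V * U′
  D = d₁ * d₁′ * e₀ * e₀′
  W = e₁ * e₀ * d₀′ * d₁′ + e₁′ * e₀′ * d₀ * d₁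
  sN≡k+sp : suc N ≡ k + suc p
  sN≡k+sp = trans (cong suc N≡k+p) (sym (+-suc k p))
  sN≡j+sq : suc N ≡ j + suc q
  sN≡j+sq = trans (cong suc N≡j+q) (sym (+-suc j q))
  SD≡ABW : S * D ≡ A * B * W
  SD≡ABW = cross-multiply A B U V U′ V′ d₀ e₀ d₁ e₁ d₀′ e₀′ d₁′ e₁′
             (a-row-ratio k (suc p) sN≡k+sp) (a-row-ratio k p N≡k+p)
             (a-row-ratio j (suc q) sN≡j+sq) (a-row-ratio j q N≡j+q)
  AB≢0 : NonZero (a (suc N) k * a (suc N) j)
  AB≢0 = m*n≢0 A B {{a-nonZero k (suc p) sN≡k+sp}} {{a-nonZero j (suc q) sN≡j+sq}}
  twice-D : ∀ n² p q P Q → 2 * (P * Q * (2 * n² * suc (2 * p)) * (2 * n² * suc (2 * q)))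
          ≡ 4 * n² * (2 * n² * (P * Q * suc (2 * p) * suc (2 * q)))
  twice-D = solve-∀
  W-factored : ∀ n² m² p q P₁ P₂ Q₁ Q₂ →
      2 * m² * suc (2 * suc p) * (2 * n² * suc (2 * p)) * Q₁ * Q₂
    + 2 * m² * suc (2 * suc q) * (2 * n² * suc (2 * q)) * P₁ * P₂
    ≡ 4 * n² * (m² * (suc (2 * p) * suc (2 * suc p) * Q₁ * Q₂ + suc (2 * q) * suc (2 * suc q) * P₁ * P₂))
  W-factored = solve-∀

ratio-transfer : ∀ c e x y x′ y′ .{{_ : NonZero y}} → c * y ≤ e * x → x * y′ ≤ x′ * y → c * y′ ≤ e * x′
ratio-transfer c e x y x′ y′ cy≤ex xy′≤x′y = *-cancelʳ-≤ (c * y′) (e * x′) y (begin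
  c * y′ * y    ≡⟨ swap c y′ y ⟩
  c * y * y′    ≤⟨ *-monoˡ-≤ y′ cy≤ex ⟩
  e * x * y′    ≡⟨ *-assoc e x y′ ⟩
  e * (x * y′)  ≤⟨ *-monoʳ-≤ e xy′≤x′y ⟩
  e * (x′ * y)  ≡⟨ *-assoc e x′ y ⟨
  e * x′ * y    ∎)
  where
  open ≤-Reasoning
  swap : ∀ c y′ y → c * y′ * y ≡ c * y * y′
  swap = solve-∀

-- The difference of
-- the two sides is an explicit polynomial in q and d with positive coefficients.
shift-inequality : ∀ q d → X (suc (q + d)) (suc q) * Y (suc (suc (q + d))) q
                         ≤ X (suc (suc (q + d))) q * Y (suc (q + d)) (suc q)
shift-inequality q d = subst (X (suc (q + d)) (suc q) * Y (suc (suc (q + d))) q ≤_)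
                             (sym (certificate q d)) (m≤m+n _ _)
  where
  -- The ring solver cannot unfold definitions, so X and Y are restated locally.
  certificate : ∀ q d →
    let cube : ℕ → ℕ
        cube x = x * x * x
        X : ℕ → ℕ → ℕ
        X p q = suc (2 * p) * suc (2 * suc p) * cube (suc q) * cube (suc (suc q))
              + suc (2 * q) * suc (2 * suc q) * cube (suc p) * cube (suc (suc p))
        Y : ℕ → ℕ → ℕ
        Y p q = cube (suc (suc p)) * cube (suc (suc q)) * suc (2 * p) * suc (2 * q)
        P : ℕ
        P = suc (q + d)
        remainder : ℕ
        remainder =
          ((((((((((((((256 * d + 256) * q
          + ((1792 * d + 10560) * d + 8768)) * q
          + (((5568 * d + 62048) * d + 194688) * d + 138208)) * q
          + ((((10112 * d + 170304) * d + 974016) * d + 2141856) * d + 1328032)) * q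
          + (((((11872 * d + 274784) * d + 2352984) * d + 9182552) * d + 15776276) * d + 8683796)) * q
          + ((((((9376 * d + 284816) * d + 3345000) * d + 19405220) * d + 58004920) * d + 82506138) * d + 40836878)) * q
          + (((((((4992 * d + 195960) * d + 3025596) * d + 24047790) * d + 106287211) * d + 259145304) * d + 316340143) * d + 142268888)) * q
          + ((((((((1728 * d + 89088) * d + 1786080) * d + 18706768) * d + 113259444) * d + 406770168) * d + 841681472) * d + 903659724) * d + 372497024)) * q
          + (((((((((352 * d + 25584) * d + 679552) * d + 9292836) * d + 74369678) * d + 366147464) * d + 1113309290) * d + 2009402548) * d + 1931812000) * d + 735302440)) * q
          + ((((((((((32 * d + 4144) * d + 157560) * d + 2882264) * d + 30308664) * d + 198016032) * d + 826737290) * d + 2190214576) * d + 3518988912) * d + 3071723174) * d + 1086647732)) * q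
          + ((((((((((280 * d + 19532) * d + 520008) * d + 7394772) * d + 63954004) * d + 356078215) * d + 1298810412) * d + 3063440485) * d + 4451902708) * d + 3568407490) * d + 1180153082)) * q
          + ((((((((((928 * d + 46720) * d + 984858) * d + 11662998) * d + 86720842) * d + 424442402) * d + 1383806964) * d + 2956735902) * d + 3938214926) * d + 2926796362) * d + 909955866)) * q
          + ((((((((((1434 * d + 58991) * d + 1057059) * d + 10919769) * d + 72139971) * d + 318087090) * d + 944686143) * d + 1855971781) * d + 2292456423) * d + 1593700857) * d + 468397458)) * q
          + ((((((((((1010 * d + 36467) * d + 583329) * d + 5447901) * d + 32862219) * d + 133377945) * d + 367135891) * d + 672620851) * d + 779286339) * d + 511325892) * d + 142940268)) * q
          + ((((((((((246 * d + 8229) * d + 122544) * d + 1069839) * d + 6054354) * d + 23129883) * d + 60116172) * d + 104314425) * d + 114838020) * d + 71869464) * d + 19260504)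
    in X (suc P) q * Y P (suc q) ≡ X P (suc q) * Y (suc P) q + remainder
  certificate = solve-∀

shift-preserves : ∀ c e {P q} → suc q ≤ P → c * Y P (suc q) ≤ e * X P (suc q) → c * Y (suc P) q ≤ e * X (suc P) q
shift-preserves c e {P} {q} q<P test with m≤n⇒∃[o]m+o≡n q<P
... | d , refl = ratio-transfer c e (X (suc (q + d)) (suc q)) (Y (suc (q + d)) (suc q))
                   (X (suc (suc (q + d))) q) (Y (suc (suc (q + d))) q) test (shift-inequality q d)

-- The only pair leaving the row is (0, N+1) (it occurs for t = N + 1).  There L ≥ 0 already
-- follows from 2·a(N+1,0)·a(N+1,N+1) ≤ a(N,0)·a(N+2,N+1), because a(N+1,0) ≤ (N+2)²·a(N,0)
-- and a(N+2,N+1) = 2(N+2)²·a(N+1,N+1).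
NonNegL-row-end : ∀ N → NonNegL N 0 (suc N)
NonNegL-row-end N = begin
  2 * A₀ * A₁                  ≤⟨ *-monoˡ-≤ A₁ (*-monoʳ-≤ 2 A₀-bound) ⟩
  2 * (m² * V₀) * A₁           ≡⟨ regroup m² V₀ A₁ ⟩
  V₀ * (A₁ * (2 * m² * 1))     ≡⟨ cong (V₀ *_) U₁≡ ⟨
  V₀ * (U₁ * 1)                ≡⟨ cong (V₀ *_) (*-identityʳ U₁) ⟩
  V₀ * U₁                      ≤⟨ m≤n+m (V₀ * U₁) _ ⟩
  a (suc (suc N)) 0 * a N (suc N) + V₀ * U₁ ∎
  where
  open ≤-Reasoning
  m² A₀ A₁ V₀ U₁ : ℕ
  m² = suc (suc N) * suc (suc N)
  A₀ = a (suc N) 0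
  A₁ = a (suc N) (suc N)
  V₀ = a N 0
  U₁ = a (suc (suc N)) (suc N)
  U₁≡ : U₁ * 1 ≡ A₁ * (2 * m² * 1)
  U₁≡ = a-row-ratio (suc N) 0 (sym (+-identityʳ (suc N)))
  A₀≡ : A₀ * cube (suc N) ≡ V₀ * (2 * (suc N * suc N) * suc (2 * N))
  A₀≡ = a-row-ratio 0 N refl
  factor-gap : ∀ N → suc (suc N) * suc (suc N) * (suc N * suc N * suc N)
             ≡ 2 * (suc N * suc N) * suc (2 * N) + suc N * suc N * (N * N * N + 5 * N * N + 4 * N + 2)
  factor-gap = solve-∀
  A₀-bound : A₀ ≤ m² * V₀
  A₀-bound = *-cancelʳ-≤ A₀ (m² * V₀) (cube (suc N)) (begin
    A₀ * cube (suc N)                          ≡⟨ A₀≡ ⟩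
    V₀ * (2 * (suc N * suc N) * suc (2 * N))   ≤⟨ *-monoʳ-≤ V₀ (m≤m+n _ _) ⟩
    V₀ * (2 * (suc N * suc N) * suc (2 * N) + suc N * suc N * (N * N * N + 5 * N * N + 4 * N + 2))
                                               ≡⟨ cong (V₀ *_) (factor-gap N) ⟨
    V₀ * (m² * cube (suc N))                   ≡⟨ *-assoc V₀ m² (cube (suc N)) ⟨
    V₀ * m² * cube (suc N)                     ≡⟨ cong (_* cube (suc N)) (*-comm V₀ m²) ⟩
    m² * V₀ * cube (suc N)                     ∎)
  regroup : ∀ m v x → 2 * (m * v) * x ≡ v * (x * (2 * m * 1))
  regroup = solve-∀

-- Inside the row the step is the shift inequality: with j = k + 1 + d and N = j + 1 + q, the
-- columns (k+1, j) have distances (q+d+1, q+1) to the row end and (k, j+1) have (q+d+2, q).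
NonNegL-step-inside : ∀ k d q → let N = suc (suc k + d) + q in
  NonNegL N (suc k) (suc k + d) → NonNegL N k (suc (suc k + d))
NonNegL-step-inside k d q holds =
  from (NonNegL⇔Reduced k (suc (suc k + d)) (suc (suc (q + d))) q (distance-k k d q) refl)
       (shift-preserves (2 * (suc N * suc N)) (suc (suc N) * suc (suc N)) (s≤s (m≤m+n q d))
          (to (NonNegL⇔Reduced (suc k) (suc k + d) (suc (q + d)) (suc q) (distance-sk k d q) (distance-j k d q)) holds))
  where
  N : ℕ
  N = suc (suc k + d) + q
  distance-sk : ∀ k d q → suc (suc k + d) + q ≡ suc k + suc (q + d)
  distance-sk = solve-∀
  distance-j : ∀ k d q → suc (suc k + d) + q ≡ (suc k + d) + suc q
  distance-j = solve-∀
  distance-k : ∀ k d q → suc (suc k + d) + q ≡ k + suc (suc (q + d))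
  distance-k = solve-∀

NonNegL-step : ∀ {N k j} → suc k ≤ j → k + suc j ≤ suc N → NonNegL N (suc k) j → NonNegL N k (suc j)
NonNegL-step {N} {k} {j} k<j within holds with suc j ≤? N
... | yes sj≤N with m≤n⇒∃[o]m+o≡n k<j | m≤n⇒∃[o]m+o≡n sj≤N
...   | d , refl | q , refl = NonNegL-step-inside k d q holds
NonNegL-step {N} {k} {j} k<j within holds | no sj≰N =
  subst₂ (λ x y → NonNegL N x (suc y)) (sym k≡0) (sym j≡N) (NonNegL-row-end N)
  where
  N≤j : N ≤ j
  N≤j = s≤s⁻¹ (≰⇒> sj≰N)
  k+j≤N : k + j ≤ N
  k+j≤N = s≤s⁻¹ (subst (_≤ suc N) (+-suc k j) within)
  k≡0 : k ≡ 0
  k≡0 = n≤0⇒n≡0 (+-cancelʳ-≤ j k 0 (≤-trans k+j≤N N≤j))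
  j≡N : j ≡ N
  j≡N = ≤-antisym (≤-trans (m≤n+m j k) k+j≤N) N≤j

NonNegL-diagonal-step : ∀ {N t k} → t ≤ suc N → 2 * suc k ≤ t →
  NonNegL N (suc k) (t ∸ suc k) → NonNegL N k (t ∸ k)
NonNegL-diagonal-step {N} {t} {k} t≤sN 2sk≤t holds with m≤n⇒∃[o]m+o≡n 2sk≤t
... | e , refl = subst (NonNegL N k) (sym t-k≡) (NonNegL-step (s≤s (m≤m+n k e)) within
                   (subst (NonNegL N (suc k)) t-sk≡ holds))
  where
  split-sk : ∀ k e → 2 * suc k + e ≡ suc k + suc (k + e)
  split-sk = solve-∀
  split-k : ∀ k e → 2 * suc k + e ≡ k + suc (suc (k + e))
  split-k = solve-∀
  t-sk≡ : 2 * suc k + e ∸ suc k ≡ suc (k + e)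
  t-sk≡ = trans (cong (_∸ suc k) (split-sk k e)) (m+n∸m≡n (suc k) (suc (k + e)))
  t-k≡ : 2 * suc k + e ∸ k ≡ suc (suc (k + e))
  t-k≡ = trans (cong (_∸ k) (split-k k e)) (m+n∸m≡n k (suc (suc (k + e))))
  within : k + suc (suc (k + e)) ≤ suc N
  within = subst (_≤ suc N) (split-k k e) t≤sN

downward : ∀ {P : ℕ → Set} → (∀ k → P (suc k) → P k) → ∀ {k m} → k ≤ m → P m → P k
downward down {m = zero} z≤n p = p
downward down {k} {suc m} k≤sm p with m≤n⇒m<n∨m≡n k≤sm
... | inj₁ k<sm = downward down (s≤s⁻¹ k<sm) (down m p)
... | inj₂ refl = p

-- A decidable, downward closed predicate has a threshold k′ ∈ ℤ (k′ = -1 if it holds nowhere):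
-- it holds at every k ≤ k′ and fails at every k′ < k ≤ b.
threshold : ∀ {P : ℕ → Set} → Decidable P → (∀ k → P (suc k) → P k) → ∀ b →
  ∃[ k′ ] ((∀ k → + k ℤ.≤ k′ → P k) × (∀ k → k ≤ b → k′ ℤ.< + k → ¬ P k))
threshold P? down zero with P? zero
... | yes p₀ = + 0 , (λ k k≤0 → downward down (drop‿+≤+ k≤0) p₀)
                   , (λ k k≤0 0<k → contradiction k≤0 (<⇒≱ (drop‿+<+ 0<k)))
... | no ¬p₀ = ℤ.-1ℤ , (λ k ()) , (λ { zero _ _ → ¬p₀ })
threshold {P} P? down (suc b) with P? (suc b)
... | yes p = + suc b , (λ k k≤b → downward down (drop‿+≤+ k≤b) p)
                      , (λ k k≤sb sb<k → contradiction k≤sb (<⇒≱ (drop‿+<+ sb<k)))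
... | no ¬p with threshold P? down b
...   | k′ , below , above = k′ , below , beyond
  where
  beyond : ∀ k → k ≤ suc b → k′ ℤ.< + k → ¬ P k
  beyond k k≤sb k′<k with m≤n⇒m<n∨m≡n k≤sb
  ... | inj₁ k<sb = above k (s≤s⁻¹ k<sb) k′<k
  ... | inj₂ refl = ¬p

L-nonneg : ∀ {N t k} → NonNegL N k (t ∸ k) → + 0 ℤ.≤ L (suc N) t k
L-nonneg {N} {t} {k} holds =
  i≤j⇒0≤j-i {+ (2 * a (suc N) k * a (suc N) (t ∸ k))}
             {+ (a (suc (suc N)) k * a N (t ∸ k) + a N k * a (suc (suc N)) (t ∸ k))} (ℤ.+≤+ holds)

L-nonpos : ∀ {N t k} → ¬ NonNegL N k (t ∸ k) → L (suc N) t k ℤ.≤ + 0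
L-nonpos {N} {t} {k} fails =
  i≤j⇒i-j≤0 {+ (a (suc (suc N)) k * a N (t ∸ k) + a N k * a (suc (suc N)) (t ∸ k))}
             {+ (2 * a (suc N) k * a (suc N) (t ∸ k))} (ℤ.+≤+ (<⇒≤ (≰⇒> fails)))

Admissible : ℕ → ℕ → ℕ → Set
Admissible N t k = 2 * k ≤ t × NonNegL N k (t ∸ k)

admissible? : ∀ N t → Decidable (Admissible N t)
admissible? N t k = (2 * k ≤? t) ×-dec (_ ≤? _)

admissible-down : ∀ {N t} → t ≤ suc N → ∀ k → Admissible N t (suc k) → Admissible N t k
admissible-down t≤sN k (2sk≤t , holds) =
  ≤-trans (*-monoʳ-≤ 2 (n≤1+n k)) 2sk≤t , NonNegL-diagonal-step t≤sN 2sk≤t holds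

theorem3p2 : ∀ (n t : ℕ) → n ≥ 1 → t ≤ n →
    ∃[ k′ ] ((∀ (k : ℕ) → 2 * k ≤ t → (+ k) ℤ.≤ k′ → + 0 ℤ.≤ L n t k)
           × (∀ (k : ℕ) → 2 * k ≤ t → k′ ℤ.< (+ k) → L n t k ℤ.≤ + 0))
theorem3p2 zero t () _
theorem3p2 (suc N) t _ t≤n with threshold (admissible? N t) (admissible-down t≤n) t
... | k′ , below , above =
  k′ , (λ k _ k≤k′ → L-nonneg {N} {t} {k} (proj₂ (below k k≤k′)))
     , (λ k 2k≤t k′<k → L-nonpos {N} {t} {k} (λ holds → above k (k≤t 2k≤t) k′<k (2k≤t , holds)))
  where
  k≤t : ∀ {k} → 2 * k ≤ t → k ≤ t
  k≤t {k} = ≤-trans (m≤m+n k (k + 0))
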